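{- Let $k>0$ be an integer. Let $G_6$ be the graph with vertices $u,v,w_1,w_2,w_3,w_4$ and edges $e_0=(u,v)$, $e_1=(u,w_1)$, $e_2=(u,w_2)$, $e_3=(v,w_3)$, $e_4=(v,w_4)$. Let $l$ be an edge labeling of $G_6$, named so that if $l(e_1)\ne l(e_2)$ then $l(e_1)=N$, $l(e_2)=F$, and if $l(e_3)\ne l(e_4)$ then $l(e_3)=N$, $l(e_4)=F$. Let $c:\{w_1,w_2,w_3,w_4\}\to\{k+2,\dots,2k+1\}$ assign distinct colors to the four vertices and be extendible with respect to $l$, meaning at least one of: (1) $l(e_1)=l(e_2)$ or $l(e_3)=l(e_4)$; (2) $l(e_0)=N$ and ($c(w_1)<c(w_2)$ iff $c(w_3)<c(w_4)$); (3) $l(e_0)=F$ and ($c(w_1)<c(w_2)$ iff $c(w_3)>c(w_4)$). Then there exist colors $c(u),c(v)\in\{1,\dots,3k+2\}$ such that the extended $c$ is a threshold-coloring of $G_6$ with respect to $l$ with threshold $k$.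
   Context: An edge labeling is a map from edges to $\{N,F\}$. A threshold-coloring with respect to $l$ with threshold $t$ is an integer vertex coloring $c$ such that for every edge $(x,y)$, $|c(x)-c(y)|\le t$ iff $l(x,y)=N$. -}

module Defs where

open import Data.Integer using (ℤ; ∣_∣; _-_; +_)
open import Data.Nat using (ℕ; _≤_)
open import Data.Product using (_×_; _,_)
open import Data.Fin using (Fin; zero; suc)
open import Relation.Binary.PropositionalEquality using (_≡_)
open import Function.Bundles using (_⇔_)

data Label : Set where
  N F : Label

data V6 : Set where
  u v w₁ w₂ w₃ w₄ : V6

E6 : Set
E6 = Fin 5

e₀ e₁ e₂ e₃ e₄ : E6
e₀ = zero
e₁ = suc zero
e₂ = suc (suc zero)
e₃ = suc (suc (suc zero))
e₄ = suc (suc (suc (suc zero)))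

ends : E6 → V6 × V6
ends zero = u , v
ends (suc zero) = u , w₁
ends (suc (suc zero)) = u , w₂
ends (suc (suc (suc zero))) = v , w₃
ends (suc (suc (suc (suc zero)))) = v , w₄

IsThresholdColoring : ℕ → (E6 → Label) → (V6 → ℤ) → Set
IsThresholdColoring t l c = (e : E6) → let (x , y) = ends e in
  (∣ c x - c y ∣ ≤ t) ⇔ (l e ≡ N)

leaf : Fin 4 → V6
leaf zero = w₁
leaf (suc zero) = w₂
leaf (suc (suc zero)) = w₃
leaf (suc (suc (suc zero))) = w₄

extend : (V6 → ℤ) → ℤ → ℤ → V6 → ℤ
extend c cu cv u = cu
extend c cu cv v = cv
extend c cu cv w₁ = c w₁
extend c cu cv w₂ = c w₂
extend c cu cv w₃ = c w₃
extend c cu cv w₄ = c w₄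

-- Write the leaf colors as k + 1 + a with 1 ≤ a ≤ k, and color u and v from the lower band
-- [1, k + 1] or the upper band [2k + 2, 3k + 2]. Colors in one band are within k of each other and
-- colors in different bands are more than k apart, so e₀ is respected exactly when the bands of u
-- and v agree (for N) or differ (for F). When the two leaf edges of u carry the same label, either
-- band has a color that is near to, resp. far from, every leaf color; when they are N and F the
-- band is forced: lower if c(w₁) < c(w₂), upper otherwise, and likewise for v. Extendibility is
-- exactly the condition that the forced bands are compatible with the label of e₀.
module Submission where

open import Defs
open import Data.Nat using (ℕ; NonZero; _<ᵇ_)
open import Data.Integer using (+_)
open import Data.Product using (_×_; _,_; ∃; ∃₂; proj₁)
open import Data.Sum using (_⊎_; inj₁; inj₂)
open import Data.Fin using (Fin; zero; suc)
open import Data.Bool using (Bool; true; false; not; T)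
open import Data.Bool.Properties using (T-≡; ⇔→≡; not-¬)
open import Function using (_∘_; const)
open import Function.Bundles using (_⇔_; mk⇔)
open import Function.Construct.Composition using (_⇔-∘_)
open import Function.Construct.Symmetry using (⇔-sym)
open import Relation.Binary.PropositionalEquality
open import Relation.Nullary using (¬_; contradiction)

⇔-inhabited : ∀ {A B : Set} → A → B → A ⇔ B
⇔-inhabited a b = mk⇔ (const b) (const a)

⇔-empty : ∀ {A B : Set} → ¬ A → ¬ B → A ⇔ B
⇔-empty ¬a ¬b = mk⇔ (λ a → contradiction a ¬a) (λ b → contradiction b ¬b)

T⇔T⇒≡ : ∀ {x y} → T x ⇔ T y → x ≡ y
T⇔T⇒≡ Tx⇔Ty = ⇔→≡ (T-≡ ⇔-∘ (Tx⇔Ty ⇔-∘ ⇔-sym T-≡))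

choose-bands : ∀ {l₁ l₂ l₃ l₄ : Label} (l₀ : Label) (o₁ o₂ : Bool) →
  (l₁ ≡ l₂ ⊎ l₃ ≡ l₄) ⊎ (l₀ ≡ N × o₁ ≡ o₂) ⊎ (l₀ ≡ F × o₁ ≡ not o₂) →
  ∃₂ λ s t → (l₁ ≡ l₂ ⊎ s ≡ o₁) × (l₃ ≡ l₄ ⊎ t ≡ o₂) × ((s ≡ t) ⇔ (l₀ ≡ N))
choose-bands N o₁ o₂ (inj₁ (inj₁ l₁≡l₂)) = o₂ , o₂ , inj₁ l₁≡l₂ , inj₂ refl , ⇔-inhabited refl refl
choose-bands F o₁ o₂ (inj₁ (inj₁ l₁≡l₂)) = not o₂ , o₂ , inj₁ l₁≡l₂ , inj₂ refl , ⇔-empty (not-¬ refl ∘ sym) λ ()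
choose-bands N o₁ o₂ (inj₁ (inj₂ l₃≡l₄)) = o₁ , o₁ , inj₂ refl , inj₁ l₃≡l₄ , ⇔-inhabited refl refl
choose-bands F o₁ o₂ (inj₁ (inj₂ l₃≡l₄)) = o₁ , not o₁ , inj₂ refl , inj₁ l₃≡l₄ , ⇔-empty (not-¬ refl) λ ()
choose-bands _ o₁ o₂ (inj₂ (inj₁ (refl , o₁≡o₂))) = o₁ , o₂ , inj₂ refl , inj₂ refl , ⇔-inhabited o₁≡o₂ refl
choose-bands _ o₁ o₂ (inj₂ (inj₂ (refl , o₁≡¬o₂))) = o₁ , o₂ , inj₂ refl , inj₂ refl , ⇔-empty (λ o₁≡o₂ → not-¬ o₁≡o₂ o₁≡¬o₂) λ ()

module _ where
  open import Data.Nat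
  open import Data.Nat.Properties
  open import Data.Nat.Tactic.RingSolver using (solve-∀)
  import Data.Integer as ℤ
  import Data.Integer.Properties as ℤ

  ∣+m-+n∣≡∣m-n∣ : ∀ m n → ℤ.∣ + m ℤ.- + n ∣ ≡ ∣ m - n ∣
  ∣+m-+n∣≡∣m-n∣ m n with ≤-total m n
  ... | inj₁ m≤n = begin
    ℤ.∣ + m ℤ.- + n ∣  ≡⟨ cong ℤ.∣_∣ (ℤ.[+m]-[+n]≡m⊖n m n) ⟩
    ℤ.∣ m ℤ.⊖ n ∣      ≡⟨ ℤ.∣⊖∣-≤ m≤n ⟩
    n ∸ m              ≡⟨ m≤n⇒∣m-n∣≡n∸m m≤n ⟨
    ∣ m - n ∣          ∎
    where open ≡-Reasoning
  ... | inj₂ n≤m = begin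
    ℤ.∣ + m ℤ.- + n ∣  ≡⟨ ℤ.∣i-j∣≡∣j-i∣ (+ m) (+ n) ⟩
    ℤ.∣ + n ℤ.- + m ∣  ≡⟨ cong ℤ.∣_∣ (ℤ.[+m]-[+n]≡m⊖n n m) ⟩
    ℤ.∣ n ℤ.⊖ m ∣      ≡⟨ ℤ.∣⊖∣-≤ n≤m ⟩
    m ∸ n              ≡⟨ m≤n⇒∣n-m∣≡n∸m n≤m ⟨
    ∣ m - n ∣          ∎
    where open ≡-Reasoning

  ∣m-n∣≤o : ∀ {m n o} → m ≤ o → n ≤ o → ∣ m - n ∣ ≤ o
  ∣m-n∣≤o {m} {n} m≤o n≤o = ≤-trans (∣m-n∣≤m⊔n m n) (⊔-lub m≤o n≤o)

  m≤∣m+n-o∣ : ∀ m {n o} → o ≤ n → m ≤ ∣ m + n - o ∣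
  m≤∣m+n-o∣ m {n} {o} o≤n = begin
    m              ≡⟨ m+n∸n≡m m n ⟨
    m + n ∸ n      ≤⟨ ∸-monoʳ-≤ (m + n) o≤n ⟩
    m + n ∸ o      ≤⟨ m∸n≤∣m-n∣ (m + n) o ⟩
    ∣ m + n - o ∣  ∎
    where open ≤-Reasoning

  ∣m-n+o∣≤n : ∀ {m} n {o} → o ≤ m → m ≤ n + o → ∣ m - n + o ∣ ≤ n
  ∣m-n+o∣≤n {m} n {o} o≤m m≤n+o = begin
    ∣ m - n + o ∣  ≡⟨ m≤n⇒∣m-n∣≡n∸m m≤n+o ⟩
    n + o ∸ m      ≤⟨ ∸-monoʳ-≤ (n + o) o≤m ⟩
    n + o ∸ o      ≡⟨ m+n∸n≡m n o ⟩
    n              ∎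
    where open ≤-Reasoning

  ∣m-n+m∣≡n : ∀ m n → ∣ m - n + m ∣ ≡ n
  ∣m-n+m∣≡n m n = trans (cong (λ x → ∣ m - x ∣) (+-comm n m)) (∣m-m+n∣≡n m n)

  2k+1≡1+k+k : ∀ k → 2 * k + 1 ≡ suc k + k
  2k+1≡1+k+k = solve-∀

  3k+2≡1+k+[1+k+k] : ∀ k → 3 * k + 2 ≡ suc k + (suc k + k)
  3k+2≡1+k+[1+k+k] = solve-∀

  <ᵇ-flip : ∀ {m n} → m ≢ n → (n <ᵇ m) ≡ not (m <ᵇ n)
  <ᵇ-flip {zero}  {zero}  m≢n = contradiction refl m≢n
  <ᵇ-flip {zero}  {suc n} _   = refl
  <ᵇ-flip {suc m} {zero}  _   = refl
  <ᵇ-flip {suc m} {suc n} m≢n = <ᵇ-flip (m≢n ∘ cong suc)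

  module _ (k : ℕ) where

    Realises : Label → ℕ → Set
    Realises l d = (d ≤ k) ⇔ (l ≡ N)

    realises-N : ∀ {d} → d ≤ k → Realises N d
    realises-N near = ⇔-inhabited near refl

    realises-F : ∀ {d} → k < d → Realises F d
    realises-F far = ⇔-empty (<⇒≱ far) λ ()

    -- band true o ∈ [1, k + 1] and band false o ∈ [2k + 2, 3k + 2] for o ≤ k. For leaf edges labelled
    -- N and F with leaf offsets a and b, the forced band is band (a <ᵇ b).
    band : Bool → ℕ → ℕ
    band true  o = suc o
    band false o = suc k + (suc k + o)

    band-range : ∀ s {o} → o ≤ k → 1 ≤ band s o × band s o ≤ suc k + (suc k + k)
    band-range true  o≤k = s≤s z≤n , ≤-trans (s≤s o≤k) (m≤m+n (suc k) (suc k + k))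
    band-range false o≤k = s≤s z≤n , +-monoʳ-≤ (suc k) (+-monoʳ-≤ (suc k) o≤k)

    bands-apart : ∀ {o} o′ → o ≤ k → k < ∣ band true o - band false o′ ∣
    bands-apart {o} o′ o≤k = begin-strict
      k                         <⟨ s≤s (m≤m+n k o′) ⟩
      suc k + o′                ≤⟨ m≤∣m+n-o∣ (suc k + o′) o≤k ⟩
      ∣ suc k + o′ + k - o ∣    ≡⟨ ∣-∣-comm (suc k + o′ + k) o ⟩
      ∣ o - suc k + o′ + k ∣    ≡⟨ cong (λ x → ∣ o - x ∣) (+-comm (suc k + o′) k) ⟩
      ∣ o - k + (suc k + o′) ∣  ∎
      where open ≤-Reasoning

    band-near⇔ : ∀ s t {o o′} → o ≤ k → o′ ≤ k → (∣ band s o - band t o′ ∣ ≤ k) ⇔ (s ≡ t)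
    band-near⇔ true  true  o≤k o′≤k = ⇔-inhabited (∣m-n∣≤o o≤k o′≤k) refl
    band-near⇔ false false {o} {o′} o≤k o′≤k = ⇔-inhabited near refl
      where
      near : ∣ band false o - band false o′ ∣ ≤ k
      near = subst (_≤ k)
        (sym (trans (∣m+n-m+o∣≡∣n-o∣ (suc k) (suc k + o) (suc k + o′)) (∣m+n-m+o∣≡∣n-o∣ (suc k) o o′)))
        (∣m-n∣≤o o≤k o′≤k)
    band-near⇔ true  false {o′ = o′} o≤k o′≤k = ⇔-empty (<⇒≱ (bands-apart o′ o≤k)) λ ()
    band-near⇔ false true  {o} {o′} o≤k o′≤k =
      ⇔-empty (<⇒≱ (subst (k <_) (∣-∣-comm (band true o′) (band false o)) (bands-apart o o′≤k))) λ ()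

    ∣upper-band-leaf∣ : ∀ o a → ∣ band false o - suc k + a ∣ ≡ ∣ suc k + o - a ∣
    ∣upper-band-leaf∣ o a = ∣m+n-m+o∣≡∣n-o∣ (suc k) (suc k + o) a

    near-leaf-lower : ∀ {a} → a ≤ k → ∣ band true k - suc k + a ∣ ≤ k
    near-leaf-lower {a} a≤k = subst (_≤ k) (sym (∣m-m+n∣≡n (suc k) a)) a≤k

    near-leaf-upper : ∀ {a} → 1 ≤ a → a ≤ k → ∣ band false 0 - suc k + a ∣ ≤ k
    near-leaf-upper {suc a} _ a<k =
      subst (_≤ k) (sym (∣upper-band-leaf∣ 0 (suc a))) (∣m-n∣≤o (≤-reflexive (+-identityʳ k)) (<⇒≤ a<k))

    far-leaf-lower : ∀ {a} → 1 ≤ a → k < ∣ band true 0 - suc k + a ∣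
    far-leaf-lower 1≤a = m<m+n k 1≤a

    far-leaf-upper : ∀ {a} → a ≤ k → k < ∣ band false k - suc k + a ∣
    far-leaf-upper {a} a≤k = subst (k <_) (sym (∣upper-band-leaf∣ k a)) (m≤∣m+n-o∣ (suc k) a≤k)

    ParentColor : Label → Label → ℕ → ℕ → Bool → Set
    ParentColor l₁ l₂ a b s =
      ∃ λ o → o ≤ k × Realises l₁ ∣ band s o - suc k + a ∣ × Realises l₂ ∣ band s o - suc k + b ∣

    split-lower : ∀ {a b} → a < b → b ≤ k → ParentColor N F a b true
    split-lower {a} {suc b} (s≤s a≤b) b<k = b , <⇒≤ b<k , realises-N near , realises-F far
      where
      near : ∣ b - k + a ∣ ≤ k
      near = ∣m-n+o∣≤n k a≤b (≤-trans (<⇒≤ b<k) (m≤m+n k a))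
      far : k < ∣ b - k + suc b ∣
      far = subst (k <_) (sym (trans (cong (λ x → ∣ b - x ∣) (+-suc k b)) (∣m-n+m∣≡n b (suc k)))) ≤-refl

    split-upper : ∀ {a b} → b < a → a ≤ k → ParentColor N F a b false
    split-upper {suc a} {b} (s≤s b≤a) a≤k = b , ≤-trans b≤a (<⇒≤ a≤k) , realises-N near , realises-F far
      where
      near : ∣ band false b - suc k + suc a ∣ ≤ k
      near = subst (_≤ k) (sym (trans (∣upper-band-leaf∣ b (suc a)) (∣-∣-comm (k + b) a)))
        (∣m-n+o∣≤n k b≤a (≤-trans (<⇒≤ a≤k) (m≤m+n k b)))
      far : k < ∣ band false b - suc k + b ∣
      far = subst (k <_) (sym (trans (∣upper-band-leaf∣ b b) (trans (∣-∣-comm (suc k + b) b) (∣m-n+m∣≡n b (suc k)))))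
        ≤-refl

    parent-color : ∀ {l₁ l₂ a b} → (l₁ ≢ l₂ → l₁ ≡ N × l₂ ≡ F) →
      1 ≤ a → a ≤ k → 1 ≤ b → b ≤ k → a ≢ b →
      ∀ s → l₁ ≡ l₂ ⊎ s ≡ (a <ᵇ b) → ParentColor l₁ l₂ a b s
    parent-color {N} {N} _ _   a≤k _   b≤k _ true  _ =
      k , ≤-refl , realises-N (near-leaf-lower a≤k) , realises-N (near-leaf-lower b≤k)
    parent-color {N} {N} _ 1≤a a≤k 1≤b b≤k _ false _ =
      0 , z≤n , realises-N (near-leaf-upper 1≤a a≤k) , realises-N (near-leaf-upper 1≤b b≤k)
    parent-color {F} {F} _ 1≤a _   1≤b _   _ true  _ =
      0 , z≤n , realises-F (far-leaf-lower 1≤a) , realises-F (far-leaf-lower 1≤b)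
    parent-color {F} {F} _ _   a≤k _   b≤k _ false _ =
      k , ≤-refl , realises-F (far-leaf-upper a≤k) , realises-F (far-leaf-upper b≤k)
    parent-color {F} {N} named _ _ _ _ _ _ _ with () ← proj₁ (named λ ())
    parent-color {N} {F} _ _ _ _ _ _ _ (inj₁ ())
    parent-color {N} {F} {a} {b} _ _ _ _ b≤k _ true (inj₂ a<ᵇb) =
      split-lower (<ᵇ⇒< a b (subst T a<ᵇb _)) b≤k
    parent-color {N} {F} {a} {b} _ _ a≤k _ _ a≢b false (inj₂ ¬a<ᵇb) =
      split-upper (≤∧≢⇒< (≮⇒≥ (subst T (sym ¬a<ᵇb) ∘ <⇒<ᵇ)) (a≢b ∘ sym)) a≤k

    leaf-offset : ∀ {x} → (+ k ℤ.+ + 2 ℤ.≤ x) × (x ℤ.≤ + 2 ℤ.* + k ℤ.+ + 1) →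
      ∃ λ a → x ≡ + (suc k + a) × 1 ≤ a × a ≤ k
    leaf-offset {+ n} (ℤ.+≤+ k+2≤n , x≤2k+1) =
      n ∸ suc k , cong +_ (sym (m+[n∸m]≡n (<⇒≤ k<n))) , m<n⇒0<n∸m k<n , a≤k
      where
      k<n : suc k < n
      k<n = subst (_≤ n) (+-comm k 2) k+2≤n
      n≤2k+1 : n ≤ suc k + k
      n≤2k+1 = ℤ.drop‿+≤+ (subst (+ n ℤ.≤_)
        (trans (cong (ℤ._+ + 1) (sym (ℤ.pos-* 2 k))) (cong +_ (2k+1≡1+k+k k))) x≤2k+1)
      a≤k : n ∸ suc k ≤ k
      a≤k = subst (n ∸ suc k ≤_) (m+n∸m≡n (suc k) k) (∸-monoˡ-≤ (suc k) n≤2k+1)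

    band-rangeℤ : ∀ s {o} → o ≤ k → (+ 1 ℤ.≤ + band s o) × (+ band s o ℤ.≤ + 3 ℤ.* + k ℤ.+ + 2)
    band-rangeℤ s o≤k with band-range s o≤k
    ... | 1≤band , band≤3k+2 = ℤ.+≤+ 1≤band , subst (+ band s _ ℤ.≤_)
      (trans (cong +_ (sym (3k+2≡1+k+[1+k+k] k))) (cong (ℤ._+ + 2) (ℤ.pos-* 3 k))) (ℤ.+≤+ band≤3k+2)

    offsets-distinct : ∀ {x y a b} → x ≡ + (suc k + a) → y ≡ + (suc k + b) → x ≢ y → a ≢ b
    offsets-distinct x≡ y≡ x≢y refl = x≢y (trans x≡ (sym y≡))

    leaf-order : ∀ {x y a b} → x ≡ + (suc k + a) → y ≡ + (suc k + b) → (x ℤ.< y) ⇔ T (a <ᵇ b)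
    leaf-order {a = a} {b} refl refl =
      mk⇔ (<⇒<ᵇ ∘ +-cancelˡ-< (suc k) a b ∘ ℤ.drop‿+<+) (ℤ.+<+ ∘ +-monoʳ-< (suc k) ∘ <ᵇ⇒< a b)

    extendible⇒orientations : ∀ {l₀ l₁ l₂ l₃ l₄ : Label} {x₁ x₂ x₃ x₄ a b c d} →
      x₁ ≡ + (suc k + a) → x₂ ≡ + (suc k + b) → x₃ ≡ + (suc k + c) → x₄ ≡ + (suc k + d) → c ≢ d →
      ((l₁ ≡ l₂) ⊎ (l₃ ≡ l₄))
        ⊎ ((l₀ ≡ N) × ((x₁ ℤ.< x₂) ⇔ (x₃ ℤ.< x₄)))
        ⊎ ((l₀ ≡ F) × ((x₁ ℤ.< x₂) ⇔ (x₃ ℤ.> x₄))) →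
      (l₁ ≡ l₂ ⊎ l₃ ≡ l₄) ⊎ (l₀ ≡ N × (a <ᵇ b) ≡ (c <ᵇ d)) ⊎ (l₀ ≡ F × (a <ᵇ b) ≡ not (c <ᵇ d))
    extendible⇒orientations _ _ _ _ _ (inj₁ same) = inj₁ same
    extendible⇒orientations x₁≡ x₂≡ x₃≡ x₄≡ _ (inj₂ (inj₁ (l₀≡N , order⇔))) =
      inj₂ (inj₁ (l₀≡N , T⇔T⇒≡ (leaf-order x₃≡ x₄≡ ⇔-∘ (order⇔ ⇔-∘ ⇔-sym (leaf-order x₁≡ x₂≡)))))
    extendible⇒orientations x₁≡ x₂≡ x₃≡ x₄≡ c≢d (inj₂ (inj₂ (l₀≡F , order⇔))) =
      inj₂ (inj₂ (l₀≡F , trans (T⇔T⇒≡ (leaf-order x₄≡ x₃≡ ⇔-∘ (order⇔ ⇔-∘ ⇔-sym (leaf-order x₁≡ x₂≡))))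
                               (<ᵇ-flip c≢d)))

    realisesℤ : ∀ {l x y z} → z ≡ + y → Realises l ∣ x - y ∣ → (ℤ.∣ + x ℤ.- z ∣ ≤ k) ⇔ (l ≡ N)
    realisesℤ {x = x} {y} refl = subst (λ d → (d ≤ k) ⇔ _) (sym (∣+m-+n∣≡∣m-n∣ x y))

    threshold-coloring : ∀ {l : E6 → Label} {c : V6 → ℤ.ℤ} {U V a₁ a₂ a₃ a₄} →
      c w₁ ≡ + (suc k + a₁) → c w₂ ≡ + (suc k + a₂) → c w₃ ≡ + (suc k + a₃) → c w₄ ≡ + (suc k + a₄) →
      Realises (l e₀) ∣ U - V ∣ →
      Realises (l e₁) ∣ U - suc k + a₁ ∣ → Realises (l e₂) ∣ U - suc k + a₂ ∣ →
      Realises (l e₃) ∣ V - suc k + a₃ ∣ → Realises (l e₄) ∣ V - suc k + a₄ ∣ →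
      IsThresholdColoring k l (extend c (+ U) (+ V))
    threshold-coloring {U = U} {V} _ _ _ _ r₀ _ _ _ _ zero = realisesℤ {x = U} {V} refl r₀
    threshold-coloring c₁≡ _ _ _ _ r₁ _ _ _ (suc zero) = realisesℤ c₁≡ r₁
    threshold-coloring _ c₂≡ _ _ _ _ r₂ _ _ (suc (suc zero)) = realisesℤ c₂≡ r₂
    threshold-coloring _ _ c₃≡ _ _ _ _ r₃ _ (suc (suc (suc zero))) = realisesℤ c₃≡ r₃
    threshold-coloring _ _ _ c₄≡ _ _ _ _ r₄ (suc (suc (suc (suc zero)))) = realisesℤ c₄≡ r₄

open import Data.Integer using (ℤ; _≤_; _<_; _>_; _+_; _*_)

mainTheorem5 : (k : ℕ) → .{{_ : NonZero k}} →
    (l : E6 → Label) →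
    (l e₁ ≢ l e₂ → (l e₁ ≡ N) × (l e₂ ≡ F)) →
    (l e₃ ≢ l e₄ → (l e₃ ≡ N) × (l e₄ ≡ F)) →
    (c : V6 → ℤ) →
    ((i : Fin 4) → (+ k + + 2 ≤ c (leaf i)) × (c (leaf i) ≤ + 2 * + k + + 1)) →
    ((i j : Fin 4) → c (leaf i) ≡ c (leaf j) → i ≡ j) →
    ((l e₁ ≡ l e₂) ⊎ (l e₃ ≡ l e₄))
      ⊎ ((l e₀ ≡ N) × ((c w₁ < c w₂) ⇔ (c w₃ < c w₄)))
      ⊎ ((l e₀ ≡ F) × ((c w₁ < c w₂) ⇔ (c w₃ > c w₄))) →
    ∃₂ λ (cu cv : ℤ) →
      (+ 1 ≤ cu) × (cu ≤ + 3 * + k + + 2) ×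
      (+ 1 ≤ cv) × (cv ≤ + 3 * + k + + 2) ×
      IsThresholdColoring k l (extend c cu cv)
mainTheorem5 k l named₁₂ named₃₄ c range distinct extendible
  with leaf-offset k (range zero) | leaf-offset k (range (suc zero))
     | leaf-offset k (range (suc (suc zero))) | leaf-offset k (range (suc (suc (suc zero))))
... | a₁ , c₁≡ , 1≤a₁ , a₁≤k | a₂ , c₂≡ , 1≤a₂ , a₂≤k | a₃ , c₃≡ , 1≤a₃ , a₃≤k | a₄ , c₄≡ , 1≤a₄ , a₄≤k
  with a₁≢a₂ ← offsets-distinct k c₁≡ c₂≡ ((λ ()) ∘ distinct zero (suc zero))
     | a₃≢a₄ ← offsets-distinct k c₃≡ c₄≡ ((λ ()) ∘ distinct (suc (suc zero)) (suc (suc (suc zero))))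
  with s , t , admissible-u , admissible-v , s≡t⇔l₀≡N ← choose-bands (l e₀) (a₁ <ᵇ a₂) (a₃ <ᵇ a₄)
         (extendible⇒orientations k c₁≡ c₂≡ c₃≡ c₄≡ a₃≢a₄ extendible)
  with o , o≤k , r₁ , r₂ ← parent-color k named₁₂ 1≤a₁ a₁≤k 1≤a₂ a₂≤k a₁≢a₂ s admissible-u
     | o′ , o′≤k , r₃ , r₄ ← parent-color k named₃₄ 1≤a₃ a₃≤k 1≤a₄ a₄≤k a₃≢a₄ t admissible-v
  with u-low , u-high ← band-rangeℤ k s o≤k
     | v-low , v-high ← band-rangeℤ k t o′≤k
  = + band k s o , + band k t o′ , u-low , u-high , v-low , v-high ,
    threshold-coloring k c₁≡ c₂≡ c₃≡ c₄≡ (s≡t⇔l₀≡N ⇔-∘ band-near⇔ k s t o≤k o′≤k) r₁ r₂ r₃ r₄
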